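{- Let $k\ge3$. Then $\gamma(\{F_{3,2},S_{k+1},K_4\}\mid S_k')\le\frac13$.
   Context: A $3$-graph is a pair $(V,E)$ with $E$ a set of $3$-subsets of $V$; $\delta_2(G)$ is the minimum over pairs of distinct vertices of the number of $3$-edges containing the pair. For a family $\mathcal F$ and a $3$-graph $H$, $\mathrm{coex}(n,\mathcal F\mid H)$ is the maximum of $\delta_2(G)$ over $n$-vertex $3$-graphs $G$ containing a subgraph isomorphic to $H$ but no subgraph isomorphic to a member of $\mathcal F$, and $\gamma(\mathcal F\mid H)=\lim_{n\to\infty}\mathrm{coex}(n,\mathcal F\mid H)/n$ (this limit exists). $F_{3,2}$ is the $3$-graph on $\{1,\dots,5\}$ with $3$-edges $123,124,125,345$. $K_4$ is the complete $3$-graph on $4$ vertices. $S_{m}$ is the star with vertex set $\{x,y_1,\dots,y_m\}$ and $3$-edges $\{xy_iy_j:1\le i<j\le m\}$. $S_k'$ is the $3$-graph with vertex set $\{x_1,x_2,y_1,\dots,y_k\}$ and $3$-edges $\{x_1y_iy_j:1\le i<j\le k\}\cup\{x_2y_iy_j:1\le i<j\le k\}$. -}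

module Defs where

open import Data.Nat using (ℕ; zero; suc; _+_; _*_; _⊓_; _<ᵇ_)
open import Data.Bool using (Bool; true; false; if_then_else_; not)
open import Data.Fin using (Fin; toℕ) renaming (zero to fz; suc to fs)
import Data.Fin as F
open import Data.List using (List; []; _∷_; map; concatMap; foldr; filterᵇ; allFin)
open import Data.List.Relation.Unary.All using (All)
open import Data.Nat.ListAction using (sum)
open import Data.Product using (Σ; _×_; _,_)
open import Relation.Binary.PropositionalEquality using (_≡_)
open import Relation.Nullary using (does)
open import Function.Definitions using (Injective)

-- A 3-graph on vertex set Fin n: a Bool-valued indicator of 3-edges on
-- ordered triples, invariant under permutations and false on triples with
-- a repeated vertex (so it encodes a set of 3-subsets of Fin n).
record Graph3 (n : ℕ) : Set where
  field
    edge  : Fin n → Fin n → Fin n → Bool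
    sym₁₂ : ∀ a b c → edge a b c ≡ edge b a c
    sym₂₃ : ∀ a b c → edge a b c ≡ edge a c b
    irrefl : ∀ a c → edge a a c ≡ false
open Graph3 public

codeg : ∀ {n} → Graph3 n → Fin n → Fin n → ℕ
codeg {n} G u v = sum (map (λ w → if edge G u v w then 1 else 0) (allFin n))

distinctPairs : (n : ℕ) → List (Fin n × Fin n)
distinctPairs n =
  concatMap (λ u → map (λ v → (u , v)) (filterᵇ (λ v → not (does (u F.≟ v))) (allFin n))) (allFin n)

-- minimum codegree δ₂(G) over pairs of distinct vertices
-- (the fold starts at n, which exceeds every codegree; for n ≥ 2 this is
-- exactly the minimum over pairs of distinct vertices)
δ₂ : ∀ {n} → Graph3 n → ℕ
δ₂ {n} G = foldr (λ p m → codeg G (Data.Product.proj₁ p) (Data.Product.proj₂ p) ⊓ m) n (distinctPairs n)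

record Pattern : Set where
  constructor mkPattern
  field
    size  : ℕ
    edges : List (Fin size × Fin size × Fin size)
open Pattern public

Contains : ∀ {n} → Graph3 n → Pattern → Set
Contains {n} G H =
  Σ (Fin (size H) → Fin n) λ φ →
    Injective _≡_ _≡_ φ ×
    All (λ { (a , b , c) → edge G (φ a) (φ b) (φ c) ≡ true }) (edges H)

ltPairs : (m : ℕ) → List (Fin m × Fin m)
ltPairs m = concatMap (λ i → map (λ j → (i , j)) (filterᵇ (λ j → toℕ i <ᵇ toℕ j) (allFin m))) (allFin m)

-- vertices of Fin 5 named 0..4 stand for 1..5 in the paper
F32 : Pattern
F32 = mkPattern 5
  ( (# 0 , # 1 , # 2) ∷ (# 0 , # 1 , # 3) ∷ (# 0 , # 1 , # 4) ∷ (# 2 , # 3 , # 4) ∷ [])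
  where open F using (#_)

K4 : Pattern
K4 = mkPattern 4
  ( (# 0 , # 1 , # 2) ∷ (# 0 , # 1 , # 3) ∷ (# 0 , # 2 , # 3) ∷ (# 1 , # 2 , # 3) ∷ [])
  where open F using (#_)

-- Star S_m: vertex fz = x, fs i = y_{i+1}; edges x y_i y_j, i < j
Star : ℕ → Pattern
Star m = mkPattern (suc m) (map (λ { (i , j) → (fz , fs i , fs j) }) (ltPairs m))

-- S'_k: vertex 0 = x₁, 1 = x₂, fs (fs i) = y_{i+1}
Star' : ℕ → Pattern
Star' k = mkPattern (suc (suc k))
  ( map (λ { (i , j) → (fz , fs (fs i) , fs (fs j)) }) (ltPairs k)
  Data.List.++ map (λ { (i , j) → (fs fz , fs (fs i) , fs (fs j)) }) (ltPairs k))

module Submission where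

-- Let k ≥ 3 and let G be an n-vertex 3-graph containing a copy of S'_k (centres
-- x₁, x₂, leaves y_1 … y_k) and no F32, S_{k+1} or K4.  We prove 3·δ₂(G) ≤ n,
-- which gives γ ≤ 1/3 (in fact with N = 0).
--
-- The argument is a weighted double count.  Every vertex z gets the weight
--   w(z) = k·(s₁(z) + s₂(z)) + 2·e(z) + 2k(k-2)·[x₁x₂z ∈ G],
-- where s_i(z) counts the leaves a with x_i y_a z ∈ G and e(z) counts the
-- ordered pairs of leaves p, q with y_p y_q z ∈ G.  A local analysis around z,
-- using only the forbidden subgraphs, shows that z has one of four profiles
-- (z on an edge x₁x₂z; a centre sees two leaves at z; a centre sees exactly
-- one leaf at z; no centre sees a leaf at z), and in each w(z) ≤ 2k(k-1).
-- Summing w over z counts the codegrees of the pairs x_i y_a, y_p y_q and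
-- x₁x₂, each at least δ₂(G), which gives Σ_z w(z) ≥ 3·δ₂(G)·2k(k-1).

open import Defs
open import Data.Nat using (ℕ; zero; suc; _+_; _*_; _⊓_; _≤_; _<_; _<ᵇ_; z≤n; s≤s)
open import Data.Nat.Properties
open import Data.Nat.Tactic.RingSolver using (solve-∀)
import Data.Nat.ListAction as ListAction
open import Data.Bool using (Bool; true; false; if_then_else_; not; T)
import Data.Bool.Properties as Bool
open import Data.Fin using (Fin; toℕ; punchIn) renaming (zero to fz; suc to fs)
import Data.Fin as Fin
open import Data.Fin.Properties using (any?; punchInᵢ≢i; toℕ-injective) renaming (0≢1+n to fz≢fs; suc-injective to fs-injective)
open import Data.Vec.Functional using (Vector)
import Data.Vec.Functional as Vec
import Data.List as List
open import Data.List.Membership.Propositional using (_∈_; lose)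
open import Data.List.Membership.Propositional.Properties
  using (∈-concatMap⁺; ∈-concatMap⁻; ∈-map⁺; ∈-map⁻; ∈-filter⁺; ∈-filter⁻; ∈-allFin)
open import Data.List.Relation.Unary.All using (All; []; _∷_)
import Data.List.Relation.Unary.All as All
import Data.List.Relation.Unary.All.Properties as All
open import Data.List.Relation.Unary.Any using (here; there; satisfied)
open import Data.Product using (∃-syntax; _×_; _,_; proj₁; proj₂)
open import Data.Sum using (_⊎_; inj₁; inj₂; [_,_]′)
open import Data.Empty using (⊥-elim)
open import Function using (_∘_; id)
open import Function.Definitions using (Injective)
open import Relation.Binary.Definitions using (tri<; tri≈; tri>)
open import Relation.Binary.PropositionalEquality
open import Relation.Nullary using (¬_; yes; no; does)
open import Relation.Nullary.Decidable using (T?; ¬?; _×-dec_; decidable-stable)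
open import Algebra.Properties.Semiring.Sum +-*-semiring
  using (sum; sum-syntax; ∑-comm; ∑-distrib-+; *-distribˡ-sum; sum-remove; sum-cong-≗)

sum-mono : ∀ {m} {f g : Vector ℕ m} → (∀ i → f i ≤ g i) → sum f ≤ sum g
sum-mono {zero}  f≤g = z≤n
sum-mono {suc m} f≤g = +-mono-≤ (f≤g fz) (sum-mono (f≤g ∘ fs))

sum-const : ∀ m c → ∑[ i < m ] c ≡ m * c
sum-const zero    c = refl
sum-const (suc m) c = cong (c +_) (sum-const m c)

⟦_⟧ : Bool → ℕ
⟦ b ⟧ = if b then 1 else 0

⟦⟧≤1 : ∀ b → ⟦ b ⟧ ≤ 1
⟦⟧≤1 true  = ≤-refl
⟦⟧≤1 false = z≤n

count : ∀ {m} → (Fin m → Bool) → ℕ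
count {m} f = ∑[ i < m ] ⟦ f i ⟧

find : ∀ {m} (f : Fin m → Bool) (b : Bool) → (∃[ i ] f i ≡ b) ⊎ (∀ i → f i ≡ not b)
find f b with any? (λ i → f i Bool.≟ b)
... | yes found = inj₁ found
... | no none   = inj₂ (λ i → Bool.¬-not (λ fi≡b → none (i , fi≡b)))

count-≤-size : ∀ {m} (f : Fin m → Bool) → count f ≤ m
count-≤-size {m} f = begin
  count f             ≤⟨ sum-mono (⟦⟧≤1 ∘ f) ⟩
  ∑[ i < m ] 1        ≡⟨ sum-const m 1 ⟩
  m * 1               ≡⟨ *-identityʳ m ⟩
  m                   ∎
  where open ≤-Reasoning

count-all-false : ∀ {m} (f : Fin m → Bool) → (∀ i → f i ≡ false) → count f ≡ 0
count-all-false {zero}  f none = refl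
count-all-false {suc m} f none rewrite none fz = count-all-false (f ∘ fs) (none ∘ fs)

count-supported : ∀ {m} (f : Fin m → Bool) (a : Fin m) →
  (∀ i → f i ≡ true → i ≡ a) → count f ≤ ⟦ f a ⟧
count-supported {suc m} f fz only-a = ≤-reflexive (begin
  ⟦ f fz ⟧ + count (f ∘ fs) ≡⟨ cong (⟦ f fz ⟧ +_) (count-all-false (f ∘ fs) elsewhere) ⟩
  ⟦ f fz ⟧ + 0               ≡⟨ +-identityʳ _ ⟩
  ⟦ f fz ⟧                   ∎)
  where
  open ≡-Reasoning
  elsewhere : ∀ i → f (fs i) ≡ false
  elsewhere i = Bool.¬-not (λ fi → fz≢fs (sym (only-a (fs i) fi)))
count-supported {suc m} f (fs a) only-a
  rewrite Bool.¬-not {f fz} {true} (λ f0 → fz≢fs (only-a fz f0))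
  = count-supported (f ∘ fs) a (λ i fi → fs-injective (only-a (fs i) fi))

count-≤1 : ∀ {m} (f : Fin m → Bool) →
  (∀ i i′ → f i ≡ true → f i′ ≡ true → i ≡ i′) → count f ≤ 1
count-≤1 f unique with find f true
... | inj₁ (a , fa) = ≤-trans (count-supported f a (λ i fi → unique i a fi fa)) (⟦⟧≤1 (f a))
... | inj₂ none     = ≤-trans (≤-reflexive (count-all-false f none)) z≤n

count-miss : ∀ {m} (f : Fin (suc m) → Bool) (a : Fin (suc m)) → f a ≡ false → count f ≤ m
count-miss {m} f a fa = begin
  count f                               ≡⟨ sum-remove {i = a} (λ i → ⟦ f i ⟧) ⟩
  ⟦ f a ⟧ + count (f ∘ punchIn a)       ≡⟨ cong (λ b → ⟦ b ⟧ + count (f ∘ punchIn a)) fa ⟩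
  count (f ∘ punchIn a)                 ≤⟨ count-≤-size (f ∘ punchIn a) ⟩
  m                                     ∎
  where open ≤-Reasoning

two-or-at-most-one : ∀ {m} (f : Fin m → Bool) →
  (∃[ a ] ∃[ b ] a ≢ b × f a ≡ true × f b ≡ true) ⊎ count f ≤ 1
two-or-at-most-one f
  with any? (λ a → any? (λ b → ¬? (a Fin.≟ b) ×-dec f a Bool.≟ true ×-dec f b Bool.≟ true))
... | yes pair = inj₁ pair
... | no none  = inj₂ (count-≤1 f unique)
  where unique : ∀ i i′ → f i ≡ true → f i′ ≡ true → i ≡ i′
        unique i i′ fi fi′ = decidable-stable (i Fin.≟ i′) (λ i≢i′ → none (i , i′ , i≢i′ , fi , fi′))

cross-count : ∀ {m} (M : Fin (suc m) → Fin (suc m) → Bool) (a : Fin (suc m)) →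
  (∀ p q → M p q ≡ true → p ≡ a ⊎ q ≡ a) →
  count (M a) ≤ 1 → count (λ p → M p a) ≤ 1 →
  ∑[ p < suc m ] count (M p) ≤ 2
cross-count {m} M a in-cross row col = begin
  ∑[ p < suc m ] count (M p)
    ≡⟨ sum-remove {i = a} (λ p → count (M p)) ⟩
  count (M a) + ∑[ i < m ] count (M (punchIn a i))
    ≤⟨ +-mono-≤ row (sum-mono off-row) ⟩
  1 + ∑[ i < m ] ⟦ M (punchIn a i) a ⟧
    ≤⟨ +-monoʳ-≤ 1 (m≤n+m _ ⟦ M a a ⟧) ⟩
  1 + (⟦ M a a ⟧ + ∑[ i < m ] ⟦ M (punchIn a i) a ⟧)
    ≡⟨ cong (1 +_) (sum-remove {i = a} (λ p → ⟦ M p a ⟧)) ⟨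
  1 + count (λ p → M p a)
    ≤⟨ +-monoʳ-≤ 1 col ⟩
  2 ∎
  where
  open ≤-Reasoning
  off-row : ∀ i → count (M (punchIn a i)) ≤ ⟦ M (punchIn a i) a ⟧
  off-row i = count-supported (M (punchIn a i)) a
    (λ q e → [ (λ p≡a → ⊥-elim (punchInᵢ≢i a i p≡a)) , id ]′ (in-cross (punchIn a i) q e))

list-sum-tabulate : ∀ {A : Set} {m} (f : Fin m → A) (g : A → ℕ) →
  ListAction.sum (List.map g (List.tabulate f)) ≡ ∑[ i < m ] g (f i)
list-sum-tabulate {m = zero}  f g = refl
list-sum-tabulate {m = suc m} f g = cong (g (f fz) +_) (list-sum-tabulate (f ∘ fs) g)

codeg-count : ∀ {n} (G : Graph3 n) u v → codeg G u v ≡ count (edge G u v)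
codeg-count G u v = list-sum-tabulate id (λ w → ⟦ edge G u v w ⟧)

foldr-⊓-≤ : ∀ {A : Set} (f : A → ℕ) (b : ℕ) {xs : List.List A} {x} → x ∈ xs →
  List.foldr (λ y r → f y ⊓ r) b xs ≤ f x
foldr-⊓-≤ f b (here refl) = m⊓n≤m (f _) _
foldr-⊓-≤ f b {y List.∷ _} (there x∈xs) = ≤-trans (m⊓n≤n (f y) _) (foldr-⊓-≤ f b x∈xs)

distinctPairs-complete : ∀ {n} {u v : Fin n} → u ≢ v → (u , v) ∈ distinctPairs n
distinctPairs-complete {n} {u} {v} u≢v = ∈-concatMap⁺ _
  (lose (∈-allFin u) (∈-map⁺ (u ,_) (∈-filter⁺ (λ w → T? (not (does (u Fin.≟ w)))) (∈-allFin v) apart)))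
  where apart : T (not (does (u Fin.≟ v)))
        apart with u Fin.≟ v
        ... | yes u≡v = u≢v u≡v
        ... | no _    = _

δ₂-≤-codeg : ∀ {n} (G : Graph3 n) {u v} → u ≢ v → δ₂ G ≤ codeg G u v
δ₂-≤-codeg {n} G u≢v = foldr-⊓-≤ (λ p → codeg G (proj₁ p) (proj₂ p)) n (distinctPairs-complete u≢v)

link-double-count : ∀ {n m} (G : Graph3 n) u (ψ : Fin m → Fin n) →
  ∑[ w < n ] count (λ a → edge G u (ψ a) w) ≡ ∑[ a < m ] codeg G u (ψ a)
link-double-count G u ψ =
  trans (∑-comm (λ w a → ⟦ edge G u (ψ a) w ⟧)) (sum-cong-≗ (λ a → sym (codeg-count G u (ψ a))))

codeg-sum-lower : ∀ {n m} (G : Graph3 n) u (ψ : Fin m → Fin n) → (∀ a → u ≢ ψ a) →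
  m * δ₂ G ≤ ∑[ a < m ] codeg G u (ψ a)
codeg-sum-lower {m = m} G u ψ apart = begin
  m * δ₂ G                    ≡⟨ sum-const m (δ₂ G) ⟨
  ∑[ a < m ] δ₂ G             ≤⟨ sum-mono (λ a → δ₂-≤-codeg G (apart a)) ⟩
  ∑[ a < m ] codeg G u (ψ a)  ∎
  where open ≤-Reasoning

codeg-sum-lower-within : ∀ {n m} (G : Graph3 n) (ψ : Fin (suc m) → Fin n) → Injective _≡_ _≡_ ψ →
  ∀ p → m * δ₂ G ≤ ∑[ q < suc m ] codeg G (ψ p) (ψ q)
codeg-sum-lower-within {m = m} G ψ ψ-inj p = begin
  m * δ₂ G
    ≤⟨ codeg-sum-lower G (ψ p) (ψ ∘ punchIn p) (λ i e → punchInᵢ≢i p i (sym (ψ-inj e))) ⟩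
  ∑[ i < m ] codeg G (ψ p) (ψ (punchIn p i))
    ≤⟨ m≤n+m _ _ ⟩
  codeg G (ψ p) (ψ p) + ∑[ i < m ] codeg G (ψ p) (ψ (punchIn p i))
    ≡⟨ sum-remove {i = p} (λ q → codeg G (ψ p) (ψ q)) ⟨
  ∑[ q < suc m ] codeg G (ψ p) (ψ q) ∎
  where open ≤-Reasoning

module Edges {n} (G : Graph3 n) where

  E : Fin n → Fin n → Fin n → Bool
  E = edge G

  swap₁₂ : ∀ a b c → E a b c ≡ E b a c
  swap₁₂ = sym₁₂ G

  swap₂₃ : ∀ a b c → E a b c ≡ E a c b
  swap₂₃ = sym₂₃ G

  rotate : ∀ a b c → E a b c ≡ E b c a
  rotate a b c = trans (swap₁₂ a b c) (swap₂₃ b a c)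

  swap₁₃ : ∀ a b c → E a b c ≡ E c b a
  swap₁₃ a b c = trans (swap₂₃ a b c) (trans (swap₁₂ a c b) (swap₂₃ c a b))

  distinct₁₂ : ∀ {a b c} → E a b c ≡ true → a ≢ b
  distinct₁₂ {a} {b} {c} e refl with () ← trans (sym e) (irrefl G a c)

  distinct₂₃ : ∀ {a b c} → E a b c ≡ true → b ≢ c
  distinct₂₃ {a} {b} {c} e = distinct₁₂ (trans (sym (rotate a b c)) e)

  distinct₁₃ : ∀ {a b c} → E a b c ≡ true → a ≢ c
  distinct₁₃ {a} {b} {c} e = distinct₁₂ (trans (sym (swap₂₃ a b c)) e)

cons-injective : ∀ {A : Set} {m} {x : A} {ψ : Vector A m} →
  (∀ i → x ≢ ψ i) → Injective _≡_ _≡_ ψ → Injective _≡_ _≡_ (x Vec.∷ ψ)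
cons-injective apart ψ-inj {fz}   {fz}   _ = refl
cons-injective apart ψ-inj {fz}   {fs j} e = ⊥-elim (apart j e)
cons-injective apart ψ-inj {fs i} {fz}   e = ⊥-elim (apart i (sym e))
cons-injective apart ψ-inj {fs i} {fs j} e = cong fs (ψ-inj e)

nil-injective : ∀ {A : Set} → Injective _≡_ _≡_ (Vec.[] {A = A})
nil-injective {x = ()}

ltPairs-complete : ∀ {m} {i j : Fin m} → toℕ i < toℕ j → (i , j) ∈ ltPairs m
ltPairs-complete {m} {i} {j} i<j = ∈-concatMap⁺ _
  (lose (∈-allFin i) (∈-map⁺ (i ,_) (∈-filter⁺ (λ j → T? (toℕ i <ᵇ toℕ j)) (∈-allFin j) (<⇒<ᵇ i<j))))

ltPairs-sound : ∀ {m} {p : Fin m × Fin m} → p ∈ ltPairs m → toℕ (proj₁ p) < toℕ (proj₂ p)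
ltPairs-sound {m} p∈ with satisfied (∈-concatMap⁻ (λ i → List.map (i ,_) (List.filterᵇ (λ j → toℕ i <ᵇ toℕ j) (List.allFin m))) {List.allFin m} p∈)
... | i , p∈row with ∈-map⁻ (i ,_) p∈row
... | j , j∈ , refl = <ᵇ⇒< _ _ (proj₂ (∈-filter⁻ (λ j → T? (toℕ i <ᵇ toℕ j)) {xs = List.allFin m} j∈))

ordered⇒distinct : ∀ {m} (R : Fin m → Fin m → Set) → (∀ i j → R i j → R j i) →
  (∀ i j → toℕ i < toℕ j → R i j) → ∀ i j → i ≢ j → R i j
ordered⇒distinct R R-sym R-< i j i≢j with <-cmp (toℕ i) (toℕ j)
... | tri< i<j _ _ = R-< i j i<j
... | tri≈ _ i≡j _ = ⊥-elim (i≢j (toℕ-injective i≡j))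
... | tri> _ _ j<i = R-sym j i (R-< j i j<i)

module Embeddings {n} (G : Graph3 n) where
  open Edges G

  f32-from : ∀ {v₀ v₁ v₂ v₃ v₄} →
    E v₀ v₁ v₂ ≡ true → E v₀ v₁ v₃ ≡ true → E v₀ v₁ v₄ ≡ true → E v₂ v₃ v₄ ≡ true →
    Contains G F32
  f32-from {v₀} {v₁} {v₂} {v₃} {v₄} e₀₁₂ e₀₁₃ e₀₁₄ e₂₃₄ =
    (v₀ Vec.∷ v₁ Vec.∷ v₂ Vec.∷ v₃ Vec.∷ v₄ Vec.∷ Vec.[]) , injective , (e₀₁₂ ∷ e₀₁₃ ∷ e₀₁₄ ∷ e₂₃₄ ∷ [])
    where
    injective =
      cons-injective (λ { fz → distinct₁₂ e₀₁₂ ; (fs fz) → distinct₁₃ e₀₁₂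
                        ; (fs (fs fz)) → distinct₁₃ e₀₁₃ ; (fs (fs (fs fz))) → distinct₁₃ e₀₁₄ })
     (cons-injective (λ { fz → distinct₂₃ e₀₁₂ ; (fs fz) → distinct₂₃ e₀₁₃ ; (fs (fs fz)) → distinct₂₃ e₀₁₄ })
     (cons-injective (λ { fz → distinct₁₂ e₂₃₄ ; (fs fz) → distinct₁₃ e₂₃₄ })
     (cons-injective (λ { fz → distinct₂₃ e₂₃₄ })
     (cons-injective (λ ()) nil-injective))))

  k4-from : ∀ {v₀ v₁ v₂ v₃} →
    E v₀ v₁ v₂ ≡ true → E v₀ v₁ v₃ ≡ true → E v₀ v₂ v₃ ≡ true → E v₁ v₂ v₃ ≡ true →
    Contains G K4
  k4-from {v₀} {v₁} {v₂} {v₃} e₀₁₂ e₀₁₃ e₀₂₃ e₁₂₃ =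
    (v₀ Vec.∷ v₁ Vec.∷ v₂ Vec.∷ v₃ Vec.∷ Vec.[]) , injective , (e₀₁₂ ∷ e₀₁₃ ∷ e₀₂₃ ∷ e₁₂₃ ∷ [])
    where
    injective =
      cons-injective (λ { fz → distinct₁₂ e₀₁₂ ; (fs fz) → distinct₁₃ e₀₁₂ ; (fs (fs fz)) → distinct₁₃ e₀₁₃ })
     (cons-injective (λ { fz → distinct₂₃ e₀₁₂ ; (fs fz) → distinct₂₃ e₀₁₃ })
     (cons-injective (λ { fz → distinct₂₃ e₀₂₃ })
     (cons-injective (λ ()) nil-injective)))

  star-from : ∀ {m} x (ψ : Fin m → Fin n) → (∀ i → x ≢ ψ i) →
    (∀ i j → i ≢ j → E x (ψ i) (ψ j) ≡ true) → Contains G (Star m)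
  star-from x ψ apart link =
    (x Vec.∷ ψ) , cons-injective apart ψ-injective ,
    All.map⁺ (All.tabulate (λ {p} p∈ → link (proj₁ p) (proj₂ p) (<⇒≢ (ltPairs-sound p∈) ∘ cong toℕ)))
    where
    ψ-injective : Injective _≡_ _≡_ ψ
    ψ-injective {i} {j} ψi≡ψj = decidable-stable (i Fin.≟ j) (λ i≢j → distinct₂₃ (link i j i≢j) ψi≡ψj)

record Centre {n m} (G : Graph3 n) (leaf : Fin m → Fin n) (x : Fin n) : Set where
  field
    apart : ∀ a → x ≢ leaf a
    link  : ∀ a b → a ≢ b → edge G x (leaf a) (leaf b) ≡ true

record DoubleStar {n} (G : Graph3 n) (k : ℕ) : Set where
  field
    centre₁ centre₂ : Fin n
    leaf            : Fin k → Fin n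
    leaf-injective  : Injective _≡_ _≡_ leaf
    centres-apart   : centre₁ ≢ centre₂
    isCentre₁       : Centre G leaf centre₁
    isCentre₂       : Centre G leaf centre₂

-- An embedding φ of S'_k gives the centres φ 0, φ 1 and the leaves φ (2 + a);
-- the embedding lists only the link edges with a < b, symmetry gives the rest.
double-star : ∀ {n k} (G : Graph3 n) → Contains G (Star' k) → DoubleStar G k
double-star {n} {k} G (φ , φ-inj , edges) = record
  { centre₁        = φ fz
  ; centre₂        = φ (fs fz)
  ; leaf           = leaf
  ; leaf-injective = fs-injective ∘ fs-injective ∘ φ-inj
  ; centres-apart  = λ e → fz≢fs (φ-inj e)
  ; isCentre₁      = record { apart = λ a e → fz≢fs (φ-inj e)
                            ; link  = full-link (All.map⁻ (All.++⁻ˡ _ edges)) }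
  ; isCentre₂      = record { apart = λ a e → fz≢fs (fs-injective (φ-inj e))
                            ; link  = full-link (All.map⁻ (All.++⁻ʳ _ edges)) }
  }
  where
  open Edges G
  leaf : Fin k → Fin n
  leaf a = φ (fs (fs a))
  full-link : ∀ {x} → All (λ p → E x (leaf (proj₁ p)) (leaf (proj₂ p)) ≡ true) (ltPairs k) →
    ∀ a b → a ≢ b → E x (leaf a) (leaf b) ≡ true
  full-link {x} ordered = ordered⇒distinct (λ a b → E x (leaf a) (leaf b) ≡ true)
    (λ a b e → trans (sym (swap₂₃ x (leaf a) (leaf b))) e)
    (λ a b a<b → All.lookup ordered (ltPairs-complete a<b))

star-extension : ∀ {n k} (G : Graph3 n) {leaf : Fin k → Fin n} {x z} → Centre G leaf x →
  x ≢ z → (∀ a → edge G x (leaf a) z ≡ true) → Contains G (Star (k + 1))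
star-extension {n} {k} G {leaf} {x} {z} C x≢z sees-z =
  subst (Contains G ∘ Star) (+-comm 1 k) (star-from x (z Vec.∷ leaf) apart′ link′)
  where
  open Edges G
  open Embeddings G
  open Centre C
  apart′ : ∀ i → x ≢ (z Vec.∷ leaf) i
  apart′ fz     = x≢z
  apart′ (fs a) = apart a
  link′ : ∀ i j → i ≢ j → E x ((z Vec.∷ leaf) i) ((z Vec.∷ leaf) j) ≡ true
  link′ fz     fz     i≢j = ⊥-elim (i≢j refl)
  link′ fz     (fs b) _   = trans (swap₂₃ x z (leaf b)) (sees-z b)
  link′ (fs a) fz     _   = sees-z a
  link′ (fs a) (fs b) i≢j = link a b (i≢j ∘ cong fs)

module Weight (j : ℕ) where

  k : ℕ
  k = 3 + j

  cross budget : ℕ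
  cross  = 2 * k * (1 + j)
  budget = 2 * k * (2 + j)

  weight : ℕ → ℕ → ℕ → ℕ → ℕ
  weight s₁ s₂ e c = k * (s₁ + s₂) + 2 * e + cross * c

  -- The targets s₁′ … c′ are explicit since weight unfolds too far to infer them.
  weight-mono : ∀ {s₁ s₂ e c} s₁′ s₂′ e′ c′ → s₁ ≤ s₁′ → s₂ ≤ s₂′ → e ≤ e′ → c ≤ c′ →
    weight s₁ s₂ e c ≤ weight s₁′ s₂′ e′ c′
  weight-mono _ _ _ _ s₁≤ s₂≤ e≤ c≤ =
    +-mono-≤ (+-mono-≤ (*-monoʳ-≤ k (+-mono-≤ s₁≤ s₂≤)) (*-monoʳ-≤ 2 e≤)) (*-monoʳ-≤ cross c≤)

  weight-cong : ∀ {s₁ s₂ e c s₁′ s₂′ e′ c′} → s₁ ≡ s₁′ → s₂ ≡ s₂′ → e ≡ e′ → c ≡ c′ →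
    weight s₁ s₂ e c ≡ weight s₁′ s₂′ e′ c′
  weight-cong refl refl refl refl = refl

  weight-sum : ∀ {m} (s₁ s₂ e c : Fin m → ℕ) →
    ∑[ z < m ] weight (s₁ z) (s₂ z) (e z) (c z) ≡ weight (sum s₁) (sum s₂) (sum e) (sum c)
  weight-sum {m} s₁ s₂ e c = begin
    ∑[ z < m ] (k * (s₁ z + s₂ z) + 2 * e z + cross * c z)
      ≡⟨ ∑-distrib-+ (λ z → k * (s₁ z + s₂ z) + 2 * e z) (λ z → cross * c z) ⟩
    ∑[ z < m ] (k * (s₁ z + s₂ z) + 2 * e z) + ∑[ z < m ] (cross * c z)
      ≡⟨ cong (_+ ∑[ z < m ] (cross * c z)) (∑-distrib-+ (λ z → k * (s₁ z + s₂ z)) (λ z → 2 * e z)) ⟩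
    ∑[ z < m ] (k * (s₁ z + s₂ z)) + ∑[ z < m ] (2 * e z) + ∑[ z < m ] (cross * c z)
      ≡⟨ cong₂ _+_ (cong₂ _+_ (*-distribˡ-sum k (λ z → s₁ z + s₂ z)) (*-distribˡ-sum 2 e)) (*-distribˡ-sum cross c) ⟨
    k * ∑[ z < m ] (s₁ z + s₂ z) + 2 * sum e + cross * sum c
      ≡⟨ cong (λ t → k * t + 2 * sum e + cross * sum c) (∑-distrib-+ s₁ s₂) ⟩
    weight (sum s₁) (sum s₂) (sum e) (sum c) ∎
    where open ≡-Reasoning

  data Profile (s₁ s₂ e : ℕ) : ℕ → Set where
    on-centre-edge : s₁ ≤ 1 → s₂ ≤ 1 → e ≡ 0 → Profile s₁ s₂ e 1
    rich           : s₁ ≤ 2 + j → s₂ ≤ 2 + j → e ≡ 0 → Profile s₁ s₂ e 0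
    thin           : s₁ ≤ 1 → s₂ ≤ 1 → e ≤ 2 → Profile s₁ s₂ e 0
    isolated       : s₁ ≡ 0 → s₂ ≡ 0 → e ≤ k * (2 + j) → Profile s₁ s₂ e 0

  -- In each shape the weight stays within the budget; the thin case needs k ≥ 3.
  open ≤-Reasoning

  weight-within-budget : ∀ {s₁ s₂ e c} → Profile s₁ s₂ e c → weight s₁ s₂ e c ≤ budget
  weight-within-budget {s₁} {s₂} (on-centre-edge s₁≤ s₂≤ refl) = begin
    weight s₁ s₂ 0 1  ≤⟨ weight-mono 1 1 0 1 s₁≤ s₂≤ ≤-refl ≤-refl ⟩
    weight 1 1 0 1  ≡⟨ identity j ⟩
    budget          ∎
    where identity : ∀ j → (3 + j) * (1 + 1) + 2 * 0 + 2 * (3 + j) * (1 + j) * 1 ≡ 2 * (3 + j) * (2 + j)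
          identity = solve-∀
  weight-within-budget {s₁} {s₂} (rich s₁≤ s₂≤ refl) = begin
    weight s₁ s₂ 0 0              ≤⟨ weight-mono (2 + j) (2 + j) 0 0 s₁≤ s₂≤ ≤-refl ≤-refl ⟩
    weight (2 + j) (2 + j) 0 0    ≡⟨ identity j ⟩
    budget                        ∎
    where identity : ∀ j → (3 + j) * ((2 + j) + (2 + j)) + 2 * 0 + 2 * (3 + j) * (1 + j) * 0 ≡ 2 * (3 + j) * (2 + j)
          identity = solve-∀
  weight-within-budget {s₁} {s₂} {e} (thin s₁≤ s₂≤ e≤) = begin
    weight s₁ s₂ e 0                      ≤⟨ weight-mono 1 1 2 0 s₁≤ s₂≤ e≤ ≤-refl ⟩
    weight 1 1 2 0                        ≤⟨ m≤m+n _ _ ⟩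
    weight 1 1 2 0 + (2 + 8 * j + 2 * j * j) ≡⟨ identity j ⟩
    budget                                ∎
    where identity : ∀ j → ((3 + j) * (1 + 1) + 2 * 2 + 2 * (3 + j) * (1 + j) * 0) + (2 + 8 * j + 2 * j * j) ≡ 2 * (3 + j) * (2 + j)
          identity = solve-∀
  weight-within-budget {e = e} (isolated refl refl e≤) = begin
    weight 0 0 e 0                  ≤⟨ weight-mono 0 0 (k * (2 + j)) 0 ≤-refl ≤-refl e≤ ≤-refl ⟩
    weight 0 0 (k * (2 + j)) 0      ≡⟨ identity j ⟩
    budget                          ∎
    where identity : ∀ j → (3 + j) * (0 + 0) + 2 * ((3 + j) * (2 + j)) + 2 * (3 + j) * (1 + j) * 0 ≡ 2 * (3 + j) * (2 + j)
          identity = solve-∀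

  weight-of-lower-bounds : ∀ δ → weight (k * δ) (k * δ) (k * ((2 + j) * δ)) δ ≡ 3 * δ * budget
  weight-of-lower-bounds δ = identity j δ
    where identity : ∀ j δ → (3 + j) * ((3 + j) * δ + (3 + j) * δ) + 2 * ((3 + j) * ((2 + j) * δ)) + 2 * (3 + j) * (1 + j) * δ ≡ 3 * δ * (2 * (3 + j) * (2 + j))
          identity = solve-∀

module LocalAnalysis {n} (G : Graph3 n) (j : ℕ) (D : DoubleStar G (3 + j))
  (no-F32 : ¬ Contains G F32) (no-star : ¬ Contains G (Star (3 + j + 1))) (no-K4 : ¬ Contains G K4)
  where

  open Edges G
  open Embeddings G
  open Weight j
  open DoubleStar D renaming (centre₁ to x₁; centre₂ to x₂; leaf to y)

  link-count : Fin n → Fin n → ℕ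
  link-count x z = count (λ a → E x (y a) z)

  leaf-pairs : Fin n → ℕ
  leaf-pairs z = ∑[ p < k ] count (λ q → E (y p) (y q) z)

  centre-pair : Fin n → ℕ
  centre-pair z = ⟦ E x₁ x₂ z ⟧

  no-leaf-pairs : ∀ {z} → (∀ {p q} → E (y p) (y q) z ≢ true) → leaf-pairs z ≡ 0
  no-leaf-pairs {z} none = begin
    leaf-pairs z    ≡⟨ sum-cong-≗ (λ p → count-all-false (λ q → E (y p) (y q) z) (λ q → Bool.¬-not none)) ⟩
    ∑[ p < k ] 0    ≡⟨ sum-const k 0 ⟩
    k * 0           ≡⟨ *-zeroʳ k ⟩
    0               ∎
    where open ≡-Reasoning

  -- No leaf pair y_p y_p is an edge, so each leaf pairs with at most k - 1 others.
  leaf-pairs-bound : ∀ z → leaf-pairs z ≤ k * (2 + j)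
  leaf-pairs-bound z = begin
    leaf-pairs z        ≤⟨ sum-mono (λ p → count-miss (λ q → E (y p) (y q) z) p (irrefl G (y p) z)) ⟩
    ∑[ p < k ] (2 + j)  ≡⟨ sum-const k (2 + j) ⟩
    k * (2 + j)         ∎
    where open ≤-Reasoning

  module _ {x} (C : Centre G y x) (z : Fin n) where
    open Centre C

    -- A leaf edge at z meets every leaf y_a with x y_a z ∈ G
    -- (else F32 on the pair x y_a and the triple z y_p y_q).
    leaf-edge-meets : ∀ {a p q} → E x (y a) z ≡ true → E (y p) (y q) z ≡ true → p ≡ a ⊎ q ≡ a
    leaf-edge-meets {a} {p} {q} xaz pqz with p Fin.≟ a | q Fin.≟ a
    ... | yes p≡a | _        = inj₁ p≡a
    ... | no _    | yes q≡a  = inj₂ q≡a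
    ... | no p≢a  | no q≢a   = ⊥-elim (no-F32 (f32-from xaz (link a p (p≢a ∘ sym)) (link a q (q≢a ∘ sym))
                                                   (trans (rotate z (y p) (y q)) pqz)))

    -- If x sees two leaves y_a, y_b at z, there is no leaf edge at z: it would
    -- have to be y_a y_b z, giving K4 on x y_a y_b z.
    two-seen-leaves : ∀ {a b} → a ≢ b → E x (y a) z ≡ true → E x (y b) z ≡ true →
      ∀ {p q} → E (y p) (y q) z ≢ true
    two-seen-leaves a≢b xaz xbz pqz with leaf-edge-meets xaz pqz | leaf-edge-meets xbz pqz
    ... | inj₁ refl | inj₁ refl = a≢b refl
    ... | inj₂ refl | inj₂ refl = a≢b refl
    ... | inj₁ refl | inj₂ refl = no-K4 (k4-from (link _ _ a≢b) xaz xbz pqz)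
    ... | inj₂ refl | inj₁ refl = no-K4 (k4-from (link _ _ (a≢b ∘ sym)) xbz xaz pqz)

    -- If x sees y_a at z, then y_a forms a leaf edge at z with at most one
    -- other leaf (else F32 on the pair z y_a and the triple x y_q y_q′) ...
    seen-leaf-row : ∀ {a} → E x (y a) z ≡ true → count (λ q → E (y a) (y q) z) ≤ 1
    seen-leaf-row {a} xaz = count-≤1 _ unique
      where
      unique : ∀ q q′ → E (y a) (y q) z ≡ true → E (y a) (y q′) z ≡ true → q ≡ q′
      unique q q′ aqz aq′z = decidable-stable (q Fin.≟ q′) (λ q≢q′ → no-F32 (f32-from
        (trans (sym (swap₁₃ x (y a) z)) xaz) (trans (rotate z (y a) (y q)) aqz)
        (trans (rotate z (y a) (y q′)) aq′z) (link q q′ q≢q′)))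

    -- ... and, all leaf edges at z meeting y_a, there are at most two
    -- ordered leaf pairs at z.
    seen-leaf : ∀ {a} → E x (y a) z ≡ true → leaf-pairs z ≤ 2
    seen-leaf {a} xaz =
      cross-count (λ p q → E (y p) (y q) z) a (λ p q → leaf-edge-meets xaz) row column
      where
      row : count (λ q → E (y a) (y q) z) ≤ 1
      row = seen-leaf-row xaz
      column : count (λ p → E (y p) (y a) z) ≤ 1
      column = subst (_≤ 1) (sum-cong-≗ (λ p → cong ⟦_⟧ (swap₁₂ (y a) (y p) z))) row

    -- x misses some leaf at z, else x, the leaves and z form S_{k+1}.
    link-count-bound : link-count x z ≤ 2 + j
    link-count-bound with find (λ a → E x (y a) z) false
    ... | inj₁ (a , missed) = count-miss (λ a → E x (y a) z) a missed
    ... | inj₂ sees-all     = ⊥-elim (no-star (star-extension G C (distinct₁₃ (sees-all fz)) sees-all))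

  -- If x x′ z ∈ G for a centre x′, then x sees at most one leaf at z
  -- (else F32 on the pair x z and the triple x′ y_a y_b).
  centre-edge-link : ∀ {x x′ z} → Centre G y x′ → E x x′ z ≡ true → link-count x z ≤ 1
  centre-edge-link {x} {x′} {z} C′ xx′z = count-≤1 _ unique
    where
    unique : ∀ a b → E x (y a) z ≡ true → E x (y b) z ≡ true → a ≡ b
    unique a b xaz xbz = decidable-stable (a Fin.≟ b) (λ a≢b → no-F32 (f32-from
      (trans (sym (swap₂₃ x x′ z)) xx′z) (trans (sym (swap₂₃ x (y a) z)) xaz)
      (trans (sym (swap₂₃ x (y b) z)) xbz) (Centre.link C′ a b a≢b)))

  -- If x₁ x₂ z ∈ G there is no leaf edge at z
  -- (else F32 on the pair y_p y_q and the triple x₁ x₂ z).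
  centre-edge-leaf-pairs : ∀ {z} → E x₁ x₂ z ≡ true → ∀ {p q} → E (y p) (y q) z ≢ true
  centre-edge-leaf-pairs x₁x₂z {p} {q} pqz = no-F32 (f32-from
    (trans (sym (rotate x₁ (y p) (y q))) (Centre.link isCentre₁ p q p≢q))
    (trans (sym (rotate x₂ (y p) (y q))) (Centre.link isCentre₂ p q p≢q)) pqz x₁x₂z)
    where p≢q = distinct₁₂ pqz ∘ cong y

  profile : ∀ z → Profile (link-count x₁ z) (link-count x₂ z) (leaf-pairs z) (centre-pair z)
  profile z with E x₁ x₂ z in x₁x₂z
  ... | true = on-centre-edge (centre-edge-link isCentre₂ x₁x₂z)
                              (centre-edge-link isCentre₁ (trans (swap₁₂ x₂ x₁ z) x₁x₂z))
                              (no-leaf-pairs (centre-edge-leaf-pairs x₁x₂z))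
  ... | false with two-or-at-most-one (λ a → E x₁ (y a) z) | two-or-at-most-one (λ a → E x₂ (y a) z)
  ...   | inj₁ (_ , _ , a≢b , xaz , xbz) | _ =
          rich (link-count-bound isCentre₁ z) (link-count-bound isCentre₂ z)
               (no-leaf-pairs (two-seen-leaves isCentre₁ z a≢b xaz xbz))
  ...   | inj₂ _ | inj₁ (_ , _ , a≢b , xaz , xbz) =
          rich (link-count-bound isCentre₁ z) (link-count-bound isCentre₂ z)
               (no-leaf-pairs (two-seen-leaves isCentre₂ z a≢b xaz xbz))
  ...   | inj₂ s₁≤1 | inj₂ s₂≤1 with find (λ a → E x₁ (y a) z) true | find (λ a → E x₂ (y a) z) true
  ...     | inj₁ (_ , xaz) | _              = thin s₁≤1 s₂≤1 (seen-leaf isCentre₁ z xaz)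
  ...     | inj₂ _         | inj₁ (_ , xaz) = thin s₁≤1 s₂≤1 (seen-leaf isCentre₂ z xaz)
  ...     | inj₂ none₁     | inj₂ none₂     =
          isolated (count-all-false _ none₁) (count-all-false _ none₂) (leaf-pairs-bound z)

  total-weight :
    ∑[ z < n ] weight (link-count x₁ z) (link-count x₂ z) (leaf-pairs z) (centre-pair z) ≡
    weight (∑[ a < k ] codeg G x₁ (y a)) (∑[ a < k ] codeg G x₂ (y a))
           (∑[ p < k ] ∑[ q < k ] codeg G (y p) (y q)) (codeg G x₁ x₂)
  total-weight = trans (weight-sum (link-count x₁) (link-count x₂) leaf-pairs centre-pair)
    (weight-cong (link-double-count G x₁ y) (link-double-count G x₂ y)
      (trans (∑-comm (λ z p → count (λ q → E (y p) (y q) z))) (sum-cong-≗ (λ p → link-double-count G (y p) y)))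
      (sym (codeg-count G x₁ x₂)))

  leaf-codeg-lower : k * ((2 + j) * δ₂ G) ≤ ∑[ p < k ] ∑[ q < k ] codeg G (y p) (y q)
  leaf-codeg-lower = begin
    k * ((2 + j) * δ₂ G)                 ≡⟨ sum-const k ((2 + j) * δ₂ G) ⟨
    ∑[ p < k ] ((2 + j) * δ₂ G)          ≤⟨ sum-mono (codeg-sum-lower-within G y leaf-injective) ⟩
    ∑[ p < k ] ∑[ q < k ] codeg G (y p) (y q) ∎
    where open ≤-Reasoning

  three-δ₂-≤-n : 3 * δ₂ G ≤ n
  three-δ₂-≤-n = *-cancelʳ-≤ (3 * δ₂ G) n budget (begin
    3 * δ₂ G * budget
      ≡⟨ weight-of-lower-bounds (δ₂ G) ⟨
    weight (k * δ₂ G) (k * δ₂ G) (k * ((2 + j) * δ₂ G)) (δ₂ G)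
      ≤⟨ weight-mono _ _ _ _ (codeg-sum-lower G x₁ y (Centre.apart isCentre₁))
                             (codeg-sum-lower G x₂ y (Centre.apart isCentre₂))
                             leaf-codeg-lower (δ₂-≤-codeg G centres-apart) ⟩
    weight (∑[ a < k ] codeg G x₁ (y a)) (∑[ a < k ] codeg G x₂ (y a))
           (∑[ p < k ] ∑[ q < k ] codeg G (y p) (y q)) (codeg G x₁ x₂)
      ≡⟨ total-weight ⟨
    ∑[ z < n ] weight (link-count x₁ z) (link-count x₂ z) (leaf-pairs z) (centre-pair z)
      ≤⟨ sum-mono (weight-within-budget ∘ profile) ⟩
    ∑[ z < n ] budget
      ≡⟨ sum-const n budget ⟩
    n * budget ∎)
    where open ≤-Reasoning

-- 3δ ≤ n means δ/n ≤ 1/3, in particular δ/n ≤ 1/3 + 1/m.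
scaled-bound : ∀ m δ n → 3 * δ ≤ n → 3 * m * δ ≤ (m + 3) * n
scaled-bound m δ n 3δ≤n = begin
  3 * m * δ    ≡⟨ cong (_* δ) (*-comm 3 m) ⟩
  m * 3 * δ    ≡⟨ *-assoc m 3 δ ⟩
  m * (3 * δ)  ≤⟨ *-monoʳ-≤ m 3δ≤n ⟩
  m * n        ≤⟨ *-monoˡ-≤ n (m≤m+n m 3) ⟩
  (m + 3) * n  ∎
  where open ≤-Reasoning

lemma2p12 : (k : ℕ) → 3 ≤ k → (m : ℕ) → 1 ≤ m →
    ∃[ N ] ((n : ℕ) → N ≤ n → (G : Graph3 n) →
      Contains G (Star' k) → ¬ Contains G F32 → ¬ Contains G (Star (k + 1)) → ¬ Contains G K4 →
      3 * m * δ₂ G ≤ (m + 3) * n)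
lemma2p12 (suc (suc (suc j))) (s≤s (s≤s (s≤s _))) m _ =
  0 , λ n _ G copy no-F32 no-star no-K4 →
    scaled-bound m (δ₂ G) n
      (LocalAnalysis.three-δ₂-≤-n G j (double-star G copy) no-F32 no-star no-K4)
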